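{- Let $C$ be the absolute constant described in the context, let $m>6C^2(C+1)$ and $l_m:=\lfloor\frac{m-2}{C+1}\rfloor$. Let $F_m(\mathbf x)=\sum_{i=1}^n a_iP_m(x_i)$ be a node of the escalator tree of $m$-gonal forms with $$a_1=a_2=\cdots=a_{(C-2)l_m+5}=1.$$ If $m-4\le a_1+a_2+\cdots+a_n$, then $F_m(\mathbf x)$ is universal (so it is a leaf of the tree).
   Context: For $x\in\mathbb Z$, $P_m(x)=\frac{m-2}{2}x^2-\frac{m-4}{2}x$. An $m$-gonal form of rank $n$ is $\sum_{i=1}^n a_iP_m(x_i)$ with positive integers $a_1\le\cdots\le a_n$; it represents $N$ if it takes the value $N$ at some integer vector, and is universal if it represents every positive integer. The truant of a non-universal form is the smallest positive integer it does not represent. The escalator tree is the rooted tree whose root is the empty form (rank $0$, truant $1$); if a node $\sum_{i=1}^k a_iP_m(x_i)$ is not universal with truant $T$, its children are all forms $\sum_{i=1}^{k+1}a_iP_m(x_i)$ with $a_{k+1}\ge a_k$ representing $T$; universal nodes have no children and are the leaves. $C$ denotes a fixed absolute constant such that, for every $m\ge3$, every $m$-gonal form that represents every positive integer up to $C(m-2)$ is universal (a known result). -}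

module Defs where

open import Data.Nat using (ℕ; zero; suc; _≤_; _<_)
import Data.Nat as ℕ
open import Data.Integer using (ℤ; +_; _-_; _*_; _+_)
open import Data.Integer.DivMod using (_/ℕ_)
open import Data.List using (List; []; _∷_; _++_; [_]; length)
open import Data.List.Relation.Unary.All using (All)
open import Data.Vec using (Vec; []; _∷_)
open import Data.Product using (∃)
open import Relation.Binary.PropositionalEquality using (_≡_)
open import Relation.Nullary using (¬_)

-- P_m(x) = ((m-2)x^2 - (m-4)x)/2   (the division is exact; computed in ℤ)
P : ℕ → ℤ → ℤ
P m x = (((+ m - + 2) * (x * x)) - ((+ m - + 4) * x)) /ℕ 2

formValue : (m : ℕ) → (as : List ℕ) → Vec ℤ (length as) → ℤ
formValue m []       []       = + 0
formValue m (a ∷ as) (x ∷ xs) = (+ a) * P m x + formValue m as xs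

data Sorted : List ℕ → Set where
  []  : Sorted []
  [-] : ∀ a → Sorted [ a ]
  _∷_ : ∀ {a b bs} → a ≤ b → Sorted (b ∷ bs) → Sorted (a ∷ b ∷ bs)

IsForm : List ℕ → Set
IsForm as = All (λ a → 1 ≤ a) as × Sorted as
  where open import Data.Product using (_×_)

Represents : ℕ → List ℕ → ℕ → Set
Represents m as N = ∃ λ (x : Vec ℤ (length as)) → formValue m as x ≡ + N

Universal : ℕ → List ℕ → Set
Universal m as = ∀ N → 1 ≤ N → Represents m as N

IsTruant : ℕ → List ℕ → ℕ → Set
IsTruant m as T = 1 ≤ T × ¬ Represents m as T × (∀ k → 1 ≤ k → k < T → Represents m as k)
  where open import Data.Product using (_×_)

data Node (m : ℕ) : List ℕ → Set where
  root  : Node m []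
  child : ∀ {as} (a : ℕ) (T : ℕ) → Node m as → IsTruant m as T →
          1 ≤ a → All (λ b → b ≤ a) as →
          Represents m (as ++ [ a ]) T → Node m (as ++ [ a ])

IsEscalationConstant : ℕ → Set
IsEscalationConstant C = ∀ m → 3 ≤ m → ∀ as → IsForm as →
  (∀ N → 1 ≤ N → N ≤ C ℕ.* (m ℕ.∸ 2) → Represents m as N) → Universal m as

-- Write m = k + 4. Then P_m(0) = 0, P_m(1) = 1, P_m(-1) = m - 3, P_m(2) = m, and P_m(x) > k
-- for every other x, so a value at most k is a subset sum of the coefficients. In an escalator
-- node each new coefficient is at most the truant, hence at most one more than the previous
-- coefficient sum; as k ≤ a_1 + ... + a_n, every n ≤ k is represented. By the defining property
-- of C it suffices to represent N ≤ C(m - 2) < (C + 1)(m - 3). Write N = n + q(m - 3) with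
-- n ≤ k and q ≤ C, represent n, and re-spend the K = (C - 2)l_m + 5 ≥ C + 2 leading ones,
-- at the arguments 1, -1 and 2, so that their contribution to n grows by q(m - 3).
-- The hypothesis m > 6C²(C + 1) is only used to get C ≤ m - 4 and K ≥ C + 2.

module Submission where

open import Defs
open import Data.Nat using (ℕ; suc; _≤_; _<_; _*_; _+_; _∸_; _/_)
open import Data.List using (List; _++_; replicate)
open import Data.Nat.ListAction using (sum)

open import Data.Nat using (zero; z≤n; s≤s; _≤?_; _%_)
open import Data.Nat.Properties
open import Data.Nat.DivMod using (m*n/n≡m; m≡m%n+[m/n]*n; m%n<n; m<n*o⇒m/o<n; m≥n⇒m/n>0)
open import Data.Nat.Tactic.RingSolver using (solve-∀)
open import Data.Nat.ListAction.Properties using (sum-++)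
open import Algebra.Properties.CommutativeSemigroup +-commutativeSemigroup using (xy∙z≈xz∙y)
open import Data.Integer as ℤ using (ℤ; +_; -[1+_]; ∣_∣)
import Data.Integer.Properties as ℤ
import Data.Integer.Tactic.RingSolver as ℤ-Solver
open import Data.List using ([]; _∷_; [_]; length)
open import Data.List.Relation.Unary.All using (All; []; _∷_)
open import Data.List.Relation.Unary.All.Properties using (++⁺)
open import Data.Vec using (Vec; []; _∷_)
open import Data.Product using (∃₂; _×_; _,_)
open import Data.Sum using (_⊎_; inj₁; inj₂)
open import Data.Empty using (⊥-elim)
open import Relation.Nullary using (yes; no)
open import Relation.Binary.PropositionalEquality hiding ([_])

triangular : ℕ → ℕ
triangular zero    = zero
triangular (suc n) = suc n + triangular n

triangular-double : ∀ n → triangular n + triangular n ≡ n * suc n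
triangular-double zero    = refl
triangular-double (suc n) = begin
  suc n + t + (suc n + t)  ≡⟨ regroup (suc n) t ⟩
  2 * suc n + (t + t)      ≡⟨ cong (λ s → 2 * suc n + s) (triangular-double n) ⟩
  2 * suc n + n * suc n    ≡⟨ factor n ⟩
  suc n * suc (suc n)      ∎
  where
  open ≡-Reasoning
  t = triangular n
  regroup : ∀ a b → a + b + (a + b) ≡ 2 * a + (b + b)
  regroup = solve-∀
  factor : ∀ n → 2 * suc n + n * suc n ≡ suc n * suc (suc n)
  factor = solve-∀

choose2 : ℤ → ℕ
choose2 (+ zero)  = 0
choose2 (+ suc n) = triangular n
choose2 -[1+ n ]  = triangular (suc n)

choose2-double : ∀ x → + choose2 x ℤ.+ + choose2 x ≡ x ℤ.* (x ℤ.- ℤ.1ℤ)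
choose2-double (+ zero)  = refl
choose2-double (+ suc n) = begin
  + (triangular n + triangular n)  ≡⟨ cong +_ (trans (triangular-double n) (*-comm n (suc n))) ⟩
  + (suc n * n)                    ≡⟨ ℤ.pos-* (suc n) n ⟩
  + suc n ℤ.* + n                  ∎
  where open ≡-Reasoning
choose2-double -[1+ n ] = cong +_ (begin
  triangular (suc n) + triangular (suc n)  ≡⟨ triangular-double (suc n) ⟩
  suc n * suc (suc n)                      ≡⟨ cong (λ j → suc n * suc (suc j)) (sym (+-identityʳ n)) ⟩
  suc n * suc (suc (n + 0))                ∎)
  where open ≡-Reasoning

+∣i∣*∣i∣≡i*i : ∀ x → + (∣ x ∣ * ∣ x ∣) ≡ x ℤ.* x
+∣i∣*∣i∣≡i*i (+ n)    = ℤ.pos-* n n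
+∣i∣*∣i∣≡i*i -[1+ n ] = refl

polygonal : ℕ → ℤ → ℕ
polygonal k x = ∣ x ∣ * ∣ x ∣ + k * choose2 x

P≡polygonal : ∀ k x → P (4 + k) x ≡ + polygonal k x
P≡polygonal k x = begin
  P (4 + k) x     ≡⟨ cong (ℤ._/ℕ 2) numerator ⟩
  + (V + V) ℤ./ℕ 2  ≡⟨ cong +_ (trans (cong (_/ 2) (double V)) (m*n/n≡m V 2)) ⟩
  + V             ∎
  where
  open ≡-Reasoning
  V = polygonal k x
  c = choose2 x
  expand : ∀ K X → (+ 4 ℤ.+ K ℤ.- + 2) ℤ.* (X ℤ.* X) ℤ.- (+ 4 ℤ.+ K ℤ.- + 4) ℤ.* X
                 ≡ X ℤ.* X ℤ.+ X ℤ.* X ℤ.+ K ℤ.* (X ℤ.* (X ℤ.- ℤ.1ℤ))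
  expand = ℤ-Solver.solve-∀
  collect : ∀ S K C → S ℤ.+ S ℤ.+ K ℤ.* (C ℤ.+ C) ≡ (S ℤ.+ K ℤ.* C) ℤ.+ (S ℤ.+ K ℤ.* C)
  collect = ℤ-Solver.solve-∀
  double : ∀ n → n + n ≡ n * 2
  double = solve-∀
  +V : + V ≡ x ℤ.* x ℤ.+ + k ℤ.* + c
  +V = cong₂ ℤ._+_ (+∣i∣*∣i∣≡i*i x) (ℤ.pos-* k c)
  numerator : (+ (4 + k) ℤ.- + 2) ℤ.* (x ℤ.* x) ℤ.- (+ (4 + k) ℤ.- + 4) ℤ.* x ≡ + (V + V)
  numerator = begin
    _                                                       ≡⟨ expand (+ k) x ⟩
    x ℤ.* x ℤ.+ x ℤ.* x ℤ.+ + k ℤ.* (x ℤ.* (x ℤ.- ℤ.1ℤ))   ≡⟨ cong (λ d → x ℤ.* x ℤ.+ x ℤ.* x ℤ.+ + k ℤ.* d) (sym (choose2-double x)) ⟩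
    x ℤ.* x ℤ.+ x ℤ.* x ℤ.+ + k ℤ.* (+ c ℤ.+ + c)           ≡⟨ collect (x ℤ.* x) (+ k) (+ c) ⟩
    (x ℤ.* x ℤ.+ + k ℤ.* + c) ℤ.+ (x ℤ.* x ℤ.+ + k ℤ.* + c) ≡⟨ sym (cong₂ ℤ._+_ +V +V) ⟩
    + (V + V)                                               ∎

polygonal-0 : ∀ k → polygonal k (+ 0) ≡ 0
polygonal-0 k = *-zeroʳ k

polygonal-1 : ∀ k → polygonal k (+ 1) ≡ 1
polygonal-1 k = cong suc (*-zeroʳ k)

polygonal-2 : ∀ k → polygonal k (+ 2) ≡ 4 + k
polygonal-2 k = cong (λ j → 4 + j) (*-identityʳ k)

polygonal-[-1] : ∀ k → polygonal k -[1+ 0 ] ≡ suc k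
polygonal-[-1] k = cong suc (*-identityʳ k)

k<[1+a]²+k*[1+t] : ∀ k a t → k < suc a * suc a + k * suc t
k<[1+a]²+k*[1+t] k a t = +-mono-≤ (s≤s z≤n) (m≤m*n k (suc t))

polygonal≤k⇒polygonal≤1 : ∀ k x → polygonal k x ≤ k → polygonal k x ≤ 1
polygonal≤k⇒polygonal≤1 k (+ 0)           _   = ≤-trans (≤-reflexive (polygonal-0 k)) z≤n
polygonal≤k⇒polygonal≤1 k (+ 1)           _   = ≤-reflexive (polygonal-1 k)
polygonal≤k⇒polygonal≤1 k (+ suc (suc n)) p≤k = ⊥-elim (≤⇒≯ p≤k (k<[1+a]²+k*[1+t] k (suc n) (n + triangular n)))
polygonal≤k⇒polygonal≤1 k -[1+ n ]        p≤k = ⊥-elim (≤⇒≯ p≤k (k<[1+a]²+k*[1+t] k n (n + triangular n)))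

value : ℕ → (as : List ℕ) → Vec ℤ (length as) → ℕ
value k []       []       = 0
value k (a ∷ as) (x ∷ xs) = a * polygonal k x + value k as xs

formValue≡value : ∀ k as xs → formValue (4 + k) as xs ≡ + value k as xs
formValue≡value k []       []       = refl
formValue≡value k (a ∷ as) (x ∷ xs) = begin
  + a ℤ.* P (4 + k) x ℤ.+ formValue (4 + k) as xs
    ≡⟨ cong₂ (λ p v → + a ℤ.* p ℤ.+ v) (P≡polygonal k x) (formValue≡value k as xs) ⟩
  + a ℤ.* + polygonal k x ℤ.+ + value k as xs
    ≡⟨ cong (ℤ._+ + value k as xs) (sym (ℤ.pos-* a (polygonal k x))) ⟩
  + value k (a ∷ as) (x ∷ xs) ∎
  where open ≡-Reasoning

data Representsℕ (k : ℕ) (as : List ℕ) : ℕ → Set where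
  at : (xs : Vec ℤ (length as)) → Representsℕ k as (value k as xs)

fromRepresents : ∀ {k as n} → Represents (4 + k) as n → Representsℕ k as n
fromRepresents {k} {as} (xs , e) =
  subst (Representsℕ k as) (ℤ.+-injective (trans (sym (formValue≡value k as xs)) e)) (at xs)

toRepresents : ∀ {k as n} → Representsℕ k as n → Represents (4 + k) as n
toRepresents {k} {as} (at xs) = xs , formValue≡value k as xs

representsℕ-∷ : ∀ {k as n a} x → Representsℕ k as n → Representsℕ k (a ∷ as) (a * polygonal k x + n)
representsℕ-∷ x (at xs) = at (x ∷ xs)

representsℕ-++ : ∀ {k as bs m n} → Representsℕ k as m → Representsℕ k bs n → Representsℕ k (as ++ bs) (m + n)
representsℕ-++ {as = []}     (at [])       rep = rep
representsℕ-++ {k} {a ∷ as} {n = n} (at (x ∷ xs)) rep =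
  subst (Representsℕ k (a ∷ as ++ _)) (sym (+-assoc (a * polygonal k x) (value k as xs) n))
        (representsℕ-∷ x (representsℕ-++ (at xs) rep))

representsℕ-split : ∀ {k} as bs {n} → Representsℕ k (as ++ bs) n →
  ∃₂ λ n₁ n₂ → Representsℕ k as n₁ × Representsℕ k bs n₂ × n₁ + n₂ ≡ n
representsℕ-split []       bs rep = 0 , _ , at [] , rep , refl
representsℕ-split {k} (a ∷ as) bs (at (x ∷ zs)) with representsℕ-split as bs (at zs)
... | n₁ , n₂ , rep₁ , rep₂ , n₁+n₂≡v =
  a * polygonal k x + n₁ , n₂ , representsℕ-∷ x rep₁ , rep₂ ,
  trans (+-assoc _ n₁ n₂) (cong (λ v → a * polygonal k x + v) n₁+n₂≡v)

scaled-polygonal-small : ∀ k a x → a * polygonal k x ≤ k → a * polygonal k x ≤ a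
scaled-polygonal-small k zero    x _   = z≤n
scaled-polygonal-small k (suc a) x a*p≤k = begin
  suc a * polygonal k x  ≤⟨ *-monoʳ-≤ (suc a) (polygonal≤k⇒polygonal≤1 k x (≤-trans (m≤m+n _ _) a*p≤k)) ⟩
  suc a * 1              ≡⟨ *-identityʳ (suc a) ⟩
  suc a                  ∎
  where open ≤-Reasoning

-- Only the arguments 0 and 1 give P_m-values of at most m - 4.
value≤k⇒value≤sum : ∀ k as xs → value k as xs ≤ k → value k as xs ≤ sum as
value≤k⇒value≤sum k []       []       _ = z≤n
value≤k⇒value≤sum k (a ∷ as) (x ∷ xs) v≤k =
  +-mono-≤ (scaled-polygonal-small k a x (≤-trans (m≤m+n _ _) v≤k))
           (value≤k⇒value≤sum k as xs (≤-trans (m≤n+m _ _) v≤k))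

representsℕ-small : ∀ {k as n} → Representsℕ k as n → n ≤ k → n ≤ sum as
representsℕ-small {k} {as} (at xs) = value≤k⇒value≤sum k as xs

representsℕ-[a]-0 : ∀ {k} a → Representsℕ k [ a ] 0
representsℕ-[a]-0 {k} a =
  subst (Representsℕ k [ a ]) (trans (+-identityʳ _) (trans (cong (a *_) (polygonal-0 k)) (*-zeroʳ a))) (at (+ 0 ∷ []))

representsℕ-[a]-a : ∀ {k} a → Representsℕ k [ a ] a
representsℕ-[a]-a {k} a =
  subst (Representsℕ k [ a ]) (trans (+-identityʳ _) (trans (cong (a *_) (polygonal-1 k)) (*-identityʳ a))) (at (+ 1 ∷ []))

representsℕ-[a]⇒0⊎≥a : ∀ {k a n} → Representsℕ k [ a ] n → n ≡ 0 ⊎ a ≤ n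
representsℕ-[a]⇒0⊎≥a {k} {a} (at (y ∷ [])) with polygonal k y
... | zero  = inj₁ (trans (+-identityʳ _) (*-zeroʳ a))
... | suc p = inj₂ (≤-trans (m≤m*n a (suc p)) (m≤m+n _ 0))

sum-snoc : ∀ as a → sum (as ++ [ a ]) ≡ a + sum as
sum-snoc as a = trans (sum-++ as [ a ]) (trans (cong (λ s → sum as + s) (+-identityʳ a)) (+-comm (sum as) a))

sorted-snoc : ∀ {as a} → Sorted as → All (_≤ a) as → Sorted (as ++ [ a ])
sorted-snoc {a = a} []      []       = [-] a
sorted-snoc {a = a} ([-] b) (b≤a ∷ []) = b≤a ∷ [-] a
sorted-snoc (p ∷ s)         (_ ∷ bs≤a) = p ∷ sorted-snoc s bs≤a

node-isForm : ∀ {m as} → Node m as → IsForm as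
node-isForm root = [] , []
node-isForm (child a T node _ 1≤a as≤a _) with node-isForm node
... | positive , sorted = ++⁺ positive (1≤a ∷ []) , sorted-snoc sorted as≤a

child-coefficient≤truant : ∀ {k as a T} → IsTruant (4 + k) as T → Representsℕ k (as ++ [ a ]) T → a ≤ T
child-coefficient≤truant {as = as} (_ , T∉as , _) rep with representsℕ-split as _ rep
... | n₁ , n₂ , rep₁ , rep₂ , n₁+n₂≡T with representsℕ-[a]⇒0⊎≥a rep₂
...   | inj₁ refl = ⊥-elim (T∉as (toRepresents (subst (Representsℕ _ as) (trans (sym (+-identityʳ n₁)) n₁+n₂≡T) rep₁)))
...   | inj₂ a≤n₂ = ≤-trans a≤n₂ (≤-trans (m≤n+m n₂ n₁) (≤-reflexive n₁+n₂≡T))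

truant≤1+sum : ∀ {k as T} → IsTruant (4 + k) as T → sum as < k → T ≤ suc (sum as)
truant≤1+sum {as = as} {T} (_ , _ , below) sum<k with T ≤? suc (sum as)
... | yes T≤ = T≤
... | no  T≰ = ⊥-elim (1+n≰n (representsℕ-small (fromRepresents {as = as} (below (suc (sum as)) (s≤s z≤n) (≰⇒> T≰))) sum<k))

-- While the coefficient sum stays below m - 4, the next coefficient is at most one more than it,
-- since it is bounded by the truant.
node-represents-initial : ∀ {k as} → Node (4 + k) as → ∀ n → n ≤ k → n ≤ sum as → Representsℕ k as n
node-represents-initial root n _ n≤0 = subst (Representsℕ _ []) (sym (n≤0⇒n≡0 n≤0)) (at [])
node-represents-initial (child {as} a T node truant _ _ rep) n n≤k n≤sum with n ≤? sum as
... | yes n≤ = subst (Representsℕ _ (as ++ [ a ])) (+-identityʳ n)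
                 (representsℕ-++ (node-represents-initial node n n≤k n≤) (representsℕ-[a]-0 a))
... | no  n≰ = subst (Representsℕ _ (as ++ [ a ])) (m∸n+n≡m a≤n)
                 (representsℕ-++ (node-represents-initial node (n ∸ a) (≤-trans (m∸n≤m n a) n≤k) n∸a≤sum)
                                 (representsℕ-[a]-a a))
  where
  sum<n : sum as < n
  sum<n = ≰⇒> n≰
  a≤n : a ≤ n
  a≤n = ≤-trans (child-coefficient≤truant truant (fromRepresents {as = as ++ [ a ]} rep))
                (≤-trans (truant≤1+sum {as = as} truant (<-≤-trans sum<n n≤k)) sum<n)
  n∸a≤sum : n ∸ a ≤ sum as
  n∸a≤sum = m≤n+o⇒m∸n≤o n a (≤-trans n≤sum (≤-reflexive (sum-snoc as a)))

sum-replicate-1 : ∀ K → sum (replicate K 1) ≡ K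
sum-replicate-1 zero    = refl
sum-replicate-1 (suc K) = cong suc (sum-replicate-1 K)

representsℕ-ones-∷ : ∀ {k K n} y → Representsℕ k (replicate K 1) n →
  Representsℕ k (replicate (suc K) 1) (polygonal k y + n)
representsℕ-ones-∷ {k} {K} {n} y rep =
  subst (Representsℕ k (replicate (suc K) 1)) (cong (_+ n) (*-identityˡ (polygonal k y))) (representsℕ-∷ y rep)

-- r, v and u of the ones are evaluated at 1, -1 and 2, with P_m-values 1, m - 3 and m.
ones-represent : ∀ {k K} r v u → r + v + u ≤ K →
  Representsℕ k (replicate K 1) (r + (v * suc k + u * (4 + k)))
ones-represent {k} {zero}  zero    zero    zero    _ = at []
ones-represent {k} {suc K} zero    zero    zero    _ =
  subst (Representsℕ k (replicate (suc K) 1)) (cong (_+ 0) (polygonal-0 k))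
        (representsℕ-ones-∷ (+ 0) (ones-represent {k} {K} 0 0 0 z≤n))
ones-represent {k} {suc K} (suc r) v       u       (s≤s h) =
  subst (Representsℕ k (replicate (suc K) 1)) (cong (_+ (r + (v * suc k + u * (4 + k)))) (polygonal-1 k))
        (representsℕ-ones-∷ (+ 1) (ones-represent r v u h))
ones-represent {k} {suc K} zero    (suc v) u       (s≤s h) =
  subst (Representsℕ k (replicate (suc K) 1))
        (trans (cong (_+ (v * suc k + u * (4 + k))) (polygonal-[-1] k)) (sym (+-assoc (suc k) (v * suc k) (u * (4 + k)))))
        (representsℕ-ones-∷ -[1+ 0 ] (ones-represent 0 v u h))
ones-represent {k} {suc K} zero    zero    (suc u) (s≤s h) =
  subst (Representsℕ k (replicate (suc K) 1)) (cong (_+ (u * (4 + k))) (polygonal-2 k))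
        (representsℕ-ones-∷ (+ 2) (ones-represent 0 0 u h))

-- t + q(m - 3) = r + v(m - 3) + um: with u = q, v = 0, r = t - 3q if 3q ≤ t,
-- and otherwise u = ⌊t/3⌋, v = q - u, r = t mod 3.
ones-absorb : ∀ {k K} t q → t ≤ K → 2 + q ≤ K → Representsℕ k (replicate K 1) (t + q * suc k)
ones-absorb {k} {K} t q t≤K 2+q≤K with 3 * q ≤? t
... | yes 3q≤t = subst (Representsℕ k (replicate K 1)) shift (ones-represent e 0 q bound)
  where
  open ≤-Reasoning
  e = t ∸ 3 * q
  3q+e≡t : 3 * q + e ≡ t
  3q+e≡t = m+[n∸m]≡n 3q≤t
  regroup : ∀ e q k → e + (0 * suc k + q * (4 + k)) ≡ 3 * q + e + q * suc k
  regroup = solve-∀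
  shift : e + (0 * suc k + q * (4 + k)) ≡ t + q * suc k
  shift = trans (regroup e q k) (cong (λ s → s + q * suc k) 3q+e≡t)
  bound : e + 0 + q ≤ K
  bound = begin
    e + 0 + q  ≡⟨ cong (_+ q) (+-identityʳ e) ⟩
    e + q      ≡⟨ +-comm e q ⟩
    q + e      ≤⟨ +-monoˡ-≤ e (m≤n*m q 3) ⟩
    3 * q + e  ≡⟨ 3q+e≡t ⟩
    t          ≤⟨ t≤K ⟩
    K          ∎
... | no 3q≰t = subst (Representsℕ k (replicate K 1)) shift (ones-represent r v u bound)
  where
  open ≤-Reasoning
  u = t / 3
  r = t % 3
  v = q ∸ u
  u<q : u < q
  u<q = m<n*o⇒m/o<n (<-≤-trans (≰⇒> 3q≰t) (≤-reflexive (*-comm 3 q)))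
  u+v≡q : u + v ≡ q
  u+v≡q = m+[n∸m]≡n (<⇒≤ u<q)
  regroup : ∀ r u v k → r + (v * suc k + u * (4 + k)) ≡ r + u * 3 + (u + v) * suc k
  regroup = solve-∀
  shift : r + (v * suc k + u * (4 + k)) ≡ t + q * suc k
  shift = trans (regroup r u v k) (cong₂ (λ a b → a + b * suc k) (sym (m≡m%n+[m/n]*n t 3)) u+v≡q)
  bound : r + v + u ≤ K
  bound = begin
    r + v + u    ≡⟨ +-assoc r v u ⟩
    r + (v + u)  ≡⟨ cong (λ x → r + x) (trans (+-comm v u) u+v≡q) ⟩
    r + q        ≤⟨ +-monoˡ-≤ q (≤-pred (m%n<n t 3)) ⟩
    2 + q        ≤⟨ 2+q≤K ⟩
    K            ∎

ones-prefix-shift : ∀ {k K} rest {n} q → Representsℕ k (replicate K 1 ++ rest) n → n ≤ k → 2 + q ≤ K →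
  Representsℕ k (replicate K 1 ++ rest) (n + q * suc k)
ones-prefix-shift {k} {K} rest q rep n≤k 2+q≤K with representsℕ-split (replicate K 1) rest rep
... | t , s , rep-t , rep-s , refl =
  subst (Representsℕ k (replicate K 1 ++ rest)) (xy∙z≈xz∙y t (q * suc k) s)
        (representsℕ-++ (ones-absorb t q t≤K 2+q≤K) rep-s)
  where
  t≤K : t ≤ K
  t≤K = ≤-trans (representsℕ-small rep-t (≤-trans (m≤m+n t s) n≤k)) (≤-reflexive (sum-replicate-1 K))

quotient≤ : ∀ {C k N} → C ≤ k → N ≤ C * (2 + k) → N / suc k ≤ C
quotient≤ {C} {k} {N} C≤k N≤ = ≤-pred (m<n*o⇒m/o<n (begin-strict
  N                  ≤⟨ N≤ ⟩
  C * (2 + k)        ≡⟨ *-suc C (suc k) ⟩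
  C + C * suc k      <⟨ +-monoˡ-< (C * suc k) (s≤s C≤k) ⟩
  suc C * suc k      ∎))
  where open ≤-Reasoning

ones-prefix-universal : ∀ {C k K} rest → IsEscalationConstant C → C ≤ k → 2 + C ≤ K →
  Node (4 + k) (replicate K 1 ++ rest) → k ≤ sum (replicate K 1 ++ rest) →
  Universal (4 + k) (replicate K 1 ++ rest)
ones-prefix-universal {C} {k} {K} rest esc C≤k 2+C≤K node k≤sum =
  esc (4 + k) (s≤s (s≤s (s≤s z≤n))) (replicate K 1 ++ rest) (node-isForm node)
      (λ N _ N≤ → toRepresents (represent N N≤))
  where
  represent : ∀ N → N ≤ C * (2 + k) → Representsℕ k (replicate K 1 ++ rest) N
  represent N N≤ =
    subst (Representsℕ k (replicate K 1 ++ rest)) (sym (m≡m%n+[m/n]*n N (suc k)))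
      (ones-prefix-shift rest (N / suc k)
        (node-represents-initial node (N % suc k) n≤k (≤-trans n≤k k≤sum)) n≤k
        (≤-trans (+-monoʳ-≤ 2 (quotient≤ C≤k N≤)) 2+C≤K))
    where
    n≤k : N % suc k ≤ k
    n≤k = ≤-pred (m%n<n N (suc k))

escalationConstant-positive : ∀ {C} → IsEscalationConstant C → 1 ≤ C
escalationConstant-positive {suc C} _   = s≤s z≤n
escalationConstant-positive {zero}  esc
  with esc 3 (s≤s (s≤s (s≤s z≤n))) [] ([] , []) (λ N 1≤N N≤0 → ⊥-elim (≤⇒≯ N≤0 1≤N)) 1 (s≤s z≤n)
... | [] , ()

4+C≤m : ∀ {C m} → 1 ≤ C → 6 * (C * C) * (C + 1) < m → 4 + C ≤ m
4+C≤m {suc c} {m} _ bound = begin-strict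
  3 + C              ≡⟨ +-comm 3 C ⟩
  C + 3              ≤⟨ +-monoʳ-≤ C (≤-trans (s≤s (s≤s (s≤s z≤n))) (m≤m*n 5 C)) ⟩
  6 * C              ≤⟨ *-monoʳ-≤ 6 (m≤m*n C C) ⟩
  6 * (C * C)        ≤⟨ m≤m*n (6 * (C * C)) (C + 1) ⟩
  6 * (C * C) * (C + 1) <⟨ bound ⟩
  m                  ∎
  where
  open ≤-Reasoning
  C = suc c

ones-count-bound : ∀ {C k} → C ≤ k → 2 + C ≤ (C ∸ 2) * ((2 + k) / suc C) + 5
ones-count-bound {C} {k} C≤k = begin
  2 + C                       ≤⟨ +-monoʳ-≤ 2 (m≤n+m∸n C 2) ⟩
  4 + (C ∸ 2)                 ≤⟨ n≤1+n _ ⟩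
  5 + (C ∸ 2)                 ≡⟨ +-comm 5 (C ∸ 2) ⟩
  (C ∸ 2) + 5                 ≡⟨ cong (_+ 5) (sym (*-identityʳ (C ∸ 2))) ⟩
  (C ∸ 2) * 1 + 5             ≤⟨ +-monoˡ-≤ 5 (*-monoʳ-≤ (C ∸ 2) (m≥n⇒m/n>0 (s≤s (m≤n⇒m≤1+n C≤k)))) ⟩
  (C ∸ 2) * ((2 + k) / suc C) + 5 ∎
  where open ≤-Reasoning

lemma4p15 : (C : ℕ) → IsEscalationConstant C →
    (m : ℕ) → 6 * (C * C) * (C + 1) < m →
    (rest : List ℕ) →
    Node m (replicate ((C ∸ 2) * ((m ∸ 2) / (suc C)) + 5) 1 ++ rest) →
    m ∸ 4 ≤ sum (replicate ((C ∸ 2) * ((m ∸ 2) / (suc C)) + 5) 1 ++ rest) →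
    Universal m (replicate ((C ∸ 2) * ((m ∸ 2) / (suc C)) + 5) 1 ++ rest)
lemma4p15 C esc m bound rest node m∸4≤sum
  with m≤n⇒∃[o]m+o≡n (4+C≤m {C} (escalationConstant-positive esc) bound)
... | d , refl =
  ones-prefix-universal rest esc (m≤m+n C d) (ones-count-bound (m≤m+n C d)) node m∸4≤sum
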